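{- Let $a,b$ be indeterminates and let $k\in\mathbb N$. Then there is a sum-of-squares proof of degree $4k$ (in $a,b$) of $$(a^2-b^2)^{2k}\le 2^{2(k-1)}(a^{2k}-b^{2k})^2,$$ i.e. $2^{2(k-1)}(a^{2k}-b^{2k})^2-(a^2-b^2)^{2k}$ is a sum of squares of polynomials of degree at most $2k$. -}

module Defs where

open import Data.Nat using (ℕ; zero; suc; _∸_; _<_) renaming (_+_ to _+ℕ_; _*_ to _*ℕ_; _^_ to _^ℕ_)
open import Data.Integer using (+_)
open import Data.Rational using (ℚ; 0ℚ; 1ℚ; _/_) renaming (_+_ to _+ℚ_; _*_ to _*ℚ_; -_ to -ℚ_)
open import Data.List using (List; []; _∷_)
open import Data.List.Relation.Unary.All using (All)
open import Data.Product using (Σ; _×_)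
open import Relation.Binary.PropositionalEquality using (_≡_)

-- A polynomial in two indeterminates a, b with rational coefficients,
-- given by its coefficient function: p i j = coefficient of a^i b^j.
Poly : Set
Poly = ℕ → ℕ → ℚ

sumTo : (ℕ → ℚ) → ℕ → ℚ
sumTo f zero = f zero
sumTo f (suc n) = sumTo f n +ℚ f (suc n)

const : ℚ → Poly
const c zero zero = c
const c _ _ = 0ℚ

varA : Poly
varA (suc zero) zero = 1ℚ
varA _ _ = 0ℚ

varB : Poly
varB zero (suc zero) = 1ℚ
varB _ _ = 0ℚ

infixl 6 _+ₚ_ _-ₚ_
infixl 7 _*ₚ_
infixr 8 _^ₚ_

_+ₚ_ : Poly → Poly → Poly
(p +ₚ q) i j = p i j +ℚ q i j

-ₚ_ : Poly → Poly
(-ₚ p) i j = -ℚ (p i j)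

_-ₚ_ : Poly → Poly → Poly
p -ₚ q = p +ₚ (-ₚ q)

_*ₚ_ : Poly → Poly → Poly
(p *ₚ q) i j = sumTo (λ s → sumTo (λ t → p s t *ℚ q (i ∸ s) (j ∸ t)) j) i

_^ₚ_ : Poly → ℕ → Poly
p ^ₚ zero = const 1ℚ
p ^ₚ suc n = p *ₚ (p ^ₚ n)

zeroP : Poly
zeroP _ _ = 0ℚ

DegreeLE : ℕ → Poly → Set
DegreeLE d p = ∀ i j → d < i +ℕ j → p i j ≡ 0ℚ

sumSquares : List Poly → Poly
sumSquares [] = zeroP
sumSquares (q ∷ qs) = (q *ₚ q) +ₚ sumSquares qs

IsSOSDeg : ℕ → Poly → Set
IsSOSDeg d p = Σ (List Poly) (λ qs → All (DegreeLE d) qs × (∀ i j → p i j ≡ sumSquares qs i j))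

natP : ℕ → Poly
natP n = const (+ n / 1)

target : ℕ → Poly
target k = natP (2 ^ℕ (2 *ℕ (k ∸ 1))) *ₚ ((varA ^ₚ (2 *ℕ k)) -ₚ (varB ^ₚ (2 *ℕ k))) ^ₚ 2
           -ₚ ((varA ^ₚ 2) -ₚ (varB ^ₚ 2)) ^ₚ (2 *ℕ k)

-- Put x = a², y = b² and k = n + 1. Since xᵏ − yᵏ = (x − y)·G with G = Σ_{i ≤ n} xⁱ yⁿ⁻ⁱ, the polynomial
-- equals (x − y)² · (S² − (x − y)²ⁿ) with S = 2ⁿ G. As 2ⁿ dominates every binomial coefficient, S = D + (x + y)ⁿ
-- with D a non-negative integer combination of monomials, and then
--   S² − (x − y)²ⁿ = (D + (x + y)ⁿ − (x − y)ⁿ) · (D + (x + y)ⁿ + (x − y)ⁿ)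
-- is a product of two such combinations, as both (x + y)ⁿ ± (x − y)ⁿ have non-negative coefficients.
-- So it is a sum of monomials xⁱ yʲ with i + j = 2n, and (x − y)² xⁱ yʲ is the square of aⁱ bʲ (a² − b²),
-- a polynomial of degree 2n + 2 = 2k.

module Submission where

open import Algebra using (CommutativeRing; IsCommutativeRing; Op₂)
import Algebra.Construct.Pointwise as Pointwise
import Algebra.Properties.CommutativeSemigroup as CommutativeSemigroupProperties
import Algebra.Properties.CommutativeSemiring.Exp as Exp
open import Algebra.Solver.Ring.AlmostCommutativeRing using (fromCommutativeRing; _-Raw-AlmostCommutative⟶_)
open import Data.Empty using (⊥-elim)
open import Data.Integer using (+_)
import Data.Integer.Properties as ℤ
open import Data.List using (List; []; _∷_; _++_; map; cartesianProductWith)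
open import Data.List.Relation.Unary.All using (All; []; _∷_)
import Data.List.Relation.Unary.All as All
import Data.List.Relation.Unary.All.Properties as All
open import Data.Maybe as Maybe using ()
open import Data.Nat as ℕ using (ℕ; zero; suc; _∸_; _≤_; z≤n)
import Data.Nat.Coprimality as Coprimality
import Data.Nat.Properties as ℕ
open import Data.Nat.Tactic.RingSolver using (solve-∀)
open import Data.Product using (Σ-syntax; _,_; _×_; proj₁; proj₂)
open import Data.Rational as ℚ using (ℚ; 0ℚ; 1ℚ; _/_)
import Data.Rational.Properties as ℚ
open import Function using (_∘_)
open import Level using (0ℓ)
open import Relation.Binary.PropositionalEquality as ≡ using (_≡_)
open import Relation.Nullary using (yes; no; dec⇒maybe)

open import Defs

module FormalPowerSeries {c ℓ} (R : CommutativeRing c ℓ) where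
  open CommutativeRing R hiding (zero)
  open import Relation.Binary.Reasoning.Setoid setoid
  open CommutativeSemigroupProperties +-commutativeSemigroup using (interchange)

  Series : Set c
  Series = ℕ → Carrier

  infix 4 _≋_
  _≋_ : Series → Series → Set ℓ
  f ≋ g = ∀ n → f n ≈ g n

  infixl 6 _⊕_
  _⊕_ : Series → Series → Series
  (f ⊕ g) n = f n + g n

  infixr 7 _·_
  _·_ : Carrier → Series → Series
  (a · f) n = a * f n

  𝟘 𝟙 : Series
  𝟘 _ = 0#
  𝟙 zero = 1#
  𝟙 (suc _) = 0#

  sum≤ : (ℕ → Carrier) → ℕ → Carrier
  sum≤ f zero = f zero
  sum≤ f (suc n) = sum≤ f n + f (suc n)

  sum≤-cong : ∀ {f g : ℕ → Carrier} n → (∀ s → s ≤ n → f s ≈ g s) → sum≤ f n ≈ sum≤ g n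
  sum≤-cong zero f≈g = f≈g zero z≤n
  sum≤-cong (suc n) f≈g =
    +-cong (sum≤-cong n (λ s s≤n → f≈g s (ℕ.m≤n⇒m≤1+n s≤n))) (f≈g (suc n) ℕ.≤-refl)

  sum≤-suc : ∀ f n → sum≤ f (suc n) ≈ f 0 + sum≤ (f ∘ suc) n
  sum≤-suc f zero = refl
  sum≤-suc f (suc n) = begin
    sum≤ f (suc n) + f (suc (suc n))          ≈⟨ +-cong (sum≤-suc f n) refl ⟩
    (f 0 + sum≤ (f ∘ suc) n) + f (suc (suc n)) ≈⟨ +-assoc _ _ _ ⟩
    f 0 + sum≤ (f ∘ suc) (suc n)               ∎

  sum≤-reverse : ∀ f n → sum≤ f n ≈ sum≤ (λ s → f (n ∸ s)) n
  sum≤-reverse f zero = refl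
  sum≤-reverse f (suc n) = begin
    sum≤ f n + f (suc n)                  ≈⟨ +-cong (sum≤-reverse f n) refl ⟩
    sum≤ (λ s → f (n ∸ s)) n + f (suc n)  ≈⟨ +-comm _ _ ⟩
    f (suc n) + sum≤ (λ s → f (n ∸ s)) n  ≈⟨ sum≤-suc (λ s → f (suc n ∸ s)) n ⟨
    sum≤ (λ s → f (suc n ∸ s)) (suc n)    ∎

  infixl 7 _⊛_
  _⊛_ : Series → Series → Series
  (f ⊛ g) n = sum≤ (λ s → f s * g (n ∸ s)) n

  -- The Cauchy product unfolded along its first factor; the ring laws are proved for this form.
  cauchy : Series → Series → Series
  cauchy f g zero = f 0 * g 0
  cauchy f g (suc n) = f 0 * g (suc n) + cauchy (f ∘ suc) g n

  ⊛≋cauchy : ∀ f g → f ⊛ g ≋ cauchy f g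
  ⊛≋cauchy f g zero = refl
  ⊛≋cauchy f g (suc n) = begin
    (f ⊛ g) (suc n)                    ≈⟨ sum≤-suc (λ s → f s * g (suc n ∸ s)) n ⟩
    f 0 * g (suc n) + (f ∘ suc ⊛ g) n  ≈⟨ +-cong refl (⊛≋cauchy (f ∘ suc) g n) ⟩
    cauchy f g (suc n)                 ∎

  ⊛-comm : ∀ f g → f ⊛ g ≋ g ⊛ f
  ⊛-comm f g n = begin
    (f ⊛ g) n                                 ≈⟨ sum≤-reverse (λ s → f s * g (n ∸ s)) n ⟩
    sum≤ (λ s → f (n ∸ s) * g (n ∸ (n ∸ s))) n  ≈⟨ sum≤-cong n swap ⟩
    (g ⊛ f) n                                 ∎
    where
    swap : ∀ s → s ≤ n → f (n ∸ s) * g (n ∸ (n ∸ s)) ≈ g s * f (n ∸ s)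
    swap s s≤n = trans (*-comm _ _) (*-cong (reflexive (≡.cong g (ℕ.m∸[m∸n]≡n s≤n))) refl)

  cauchy-cong : ∀ {f f′ g g′} → f ≋ f′ → g ≋ g′ → cauchy f g ≋ cauchy f′ g′
  cauchy-cong f≋f′ g≋g′ zero = *-cong (f≋f′ 0) (g≋g′ 0)
  cauchy-cong f≋f′ g≋g′ (suc n) = +-cong (*-cong (f≋f′ 0) (g≋g′ (suc n))) (cauchy-cong (f≋f′ ∘ suc) g≋g′ n)

  cauchy-distribʳ : ∀ f g h → cauchy (f ⊕ g) h ≋ cauchy f h ⊕ cauchy g h
  cauchy-distribʳ f g h zero = distribʳ (h 0) (f 0) (g 0)
  cauchy-distribʳ f g h (suc n) =
    trans (+-cong (distribʳ _ _ _) (cauchy-distribʳ (f ∘ suc) (g ∘ suc) h n)) (interchange _ _ _ _)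

  cauchy-distribˡ : ∀ f g h → cauchy f (g ⊕ h) ≋ cauchy f g ⊕ cauchy f h
  cauchy-distribˡ f g h zero = distribˡ (f 0) (g 0) (h 0)
  cauchy-distribˡ f g h (suc n) =
    trans (+-cong (distribˡ _ _ _) (cauchy-distribˡ (f ∘ suc) g h n)) (interchange _ _ _ _)

  cauchy-·ˡ : ∀ a f g → cauchy (a · f) g ≋ a · cauchy f g
  cauchy-·ˡ a f g zero = *-assoc _ _ _
  cauchy-·ˡ a f g (suc n) =
    trans (+-cong (*-assoc _ _ _) (cauchy-·ˡ a (f ∘ suc) g n)) (sym (distribˡ _ _ _))

  cauchy-assoc : ∀ f g h → cauchy (cauchy f g) h ≋ cauchy f (cauchy g h)
  cauchy-assoc f g h zero = *-assoc _ _ _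
  cauchy-assoc f g h (suc n) = begin
    (f 0 * g 0) * h (suc n) + cauchy (f 0 · g ∘ suc ⊕ cauchy (f ∘ suc) g) h n
      ≈⟨ +-cong (*-assoc _ _ _) (cauchy-distribʳ (f 0 · g ∘ suc) (cauchy (f ∘ suc) g) h n) ⟩
    f 0 * (g 0 * h (suc n)) + (cauchy (f 0 · g ∘ suc) h n + cauchy (cauchy (f ∘ suc) g) h n)
      ≈⟨ +-cong refl (+-cong (cauchy-·ˡ (f 0) (g ∘ suc) h n) (cauchy-assoc (f ∘ suc) g h n)) ⟩
    f 0 * (g 0 * h (suc n)) + (f 0 * cauchy (g ∘ suc) h n + cauchy (f ∘ suc) (cauchy g h) n)
      ≈⟨ +-assoc _ _ _ ⟨
    (f 0 * (g 0 * h (suc n)) + f 0 * cauchy (g ∘ suc) h n) + cauchy (f ∘ suc) (cauchy g h) n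
      ≈⟨ +-cong (sym (distribˡ _ _ _)) refl ⟩
    cauchy f (cauchy g h) (suc n) ∎

  cauchy-zeroˡ : ∀ g → cauchy 𝟘 g ≋ 𝟘
  cauchy-zeroˡ g zero = zeroˡ _
  cauchy-zeroˡ g (suc n) = trans (+-cong (zeroˡ _) (cauchy-zeroˡ g n)) (+-identityˡ _)

  cauchy-identityˡ : ∀ g → cauchy 𝟙 g ≋ g
  cauchy-identityˡ g zero = *-identityˡ _
  cauchy-identityˡ g (suc n) = trans (+-cong (*-identityˡ _) (cauchy-zeroˡ g n)) (+-identityʳ _)

  commutativeRing : CommutativeRing c ℓ
  commutativeRing = record
    { Carrier = Series
    ; _≈_ = _≋_
    ; _+_ = _⊕_
    ; _*_ = _⊛_
    ; -_ = λ f n → - f n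
    ; 0# = 𝟘
    ; 1# = 𝟙
    ; isCommutativeRing = record
      { isRing = record
        { +-isAbelianGroup = Pointwise.isAbelianGroup ℕ +-isAbelianGroup
        ; *-cong = λ {f} {f′} {g} {g′} f≋f′ g≋g′ n →
            trans (⊛≋cauchy f g n) (trans (cauchy-cong f≋f′ g≋g′ n) (sym (⊛≋cauchy f′ g′ n)))
        ; *-assoc = λ f g h n → begin
            (f ⊛ g ⊛ h) n                ≈⟨ ⊛≋cauchy _ _ n ⟩
            cauchy (f ⊛ g) h n           ≈⟨ cauchy-cong (⊛≋cauchy f g) (λ _ → refl) n ⟩
            cauchy (cauchy f g) h n      ≈⟨ cauchy-assoc f g h n ⟩
            cauchy f (cauchy g h) n      ≈⟨ cauchy-cong (λ _ → refl) (sym ∘ ⊛≋cauchy g h) n ⟩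
            cauchy f (g ⊛ h) n           ≈⟨ ⊛≋cauchy _ _ n ⟨
            (f ⊛ (g ⊛ h)) n              ∎
        ; *-identity = identityˡ , λ f n → trans (⊛-comm f 𝟙 n) (identityˡ f n)
        ; distrib = (λ f g h n → begin
            (f ⊛ (g ⊕ h)) n               ≈⟨ ⊛≋cauchy _ _ n ⟩
            cauchy f (g ⊕ h) n            ≈⟨ cauchy-distribˡ f g h n ⟩
            cauchy f g n + cauchy f h n   ≈⟨ +-cong (⊛≋cauchy _ _ n) (⊛≋cauchy _ _ n) ⟨
            (f ⊛ g ⊕ f ⊛ h) n             ∎)
          , (λ h f g n → begin
            ((f ⊕ g) ⊛ h) n               ≈⟨ ⊛≋cauchy _ _ n ⟩
            cauchy (f ⊕ g) h n            ≈⟨ cauchy-distribʳ f g h n ⟩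
            cauchy f h n + cauchy g h n   ≈⟨ +-cong (⊛≋cauchy _ _ n) (⊛≋cauchy _ _ n) ⟨
            (f ⊛ h ⊕ g ⊛ h) n             ∎)
        }
      ; *-comm = ⊛-comm
      }
    }
    where
    identityˡ : ∀ f → 𝟙 ⊛ f ≋ f
    identityˡ f n = trans (⊛≋cauchy 𝟙 f n) (cauchy-identityˡ f n)

module _ {c ℓ} (R : CommutativeRing c ℓ) where
  open CommutativeRing R

  isCommutativeRing-resp-*-1 : (_*′_ : Op₂ Carrier) (1′ : Carrier) →
    (∀ x y → x *′ y ≈ x * y) → 1′ ≈ 1# → IsCommutativeRing _≈_ _+_ _*′_ -_ 0# 1′
  isCommutativeRing-resp-*-1 _*′_ 1′ *′≈* 1′≈1 = record
    { isRing = record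
      { +-isAbelianGroup = +-isAbelianGroup
      ; *-cong = λ {x} {y} {u} {v} x≈y u≈v → trans (*′≈* x u) (trans (*-cong x≈y u≈v) (sym (*′≈* y v)))
      ; *-assoc = λ x y z → trans (*′≈* _ _) (trans (*-cong (*′≈* x y) refl)
          (trans (*-assoc x y z) (sym (trans (*′≈* _ _) (*-cong refl (*′≈* y z))))))
      ; *-identity = (λ x → trans (*′≈* 1′ x) (trans (*-cong 1′≈1 refl) (*-identityˡ x)))
                   , (λ x → trans (*′≈* x 1′) (trans (*-cong refl 1′≈1) (*-identityʳ x)))
      ; distrib = (λ x y z → trans (*′≈* _ _) (trans (distribˡ x y z) (sym (+-cong (*′≈* x y) (*′≈* x z)))))
                , (λ x y z → trans (*′≈* _ _) (trans (distribʳ x y z) (sym (+-cong (*′≈* y x) (*′≈* z x)))))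
      }
    ; *-comm = λ x y → trans (*′≈* x y) (trans (*-comm x y) (sym (*′≈* y x)))
    }

-- Poly is ℚ[[b]][[a]]: the product _*ₚ_ of Defs is the Cauchy product of these series.
module Series₁ = FormalPowerSeries ℚ.+-*-commutativeRing
module Series₂ = FormalPowerSeries Series₁.commutativeRing

sumTo≡sum≤ : ∀ f n → sumTo f n ≡ Series₁.sum≤ f n
sumTo≡sum≤ f zero = ≡.refl
sumTo≡sum≤ f (suc n) = ≡.cong (ℚ._+ f (suc n)) (sumTo≡sum≤ f n)

sum≤-coefficient : ∀ F n j → Series₂.sum≤ F n j ≡ Series₁.sum≤ (λ s → F s j) n
sum≤-coefficient F zero j = ≡.refl
sum≤-coefficient F (suc n) j = ≡.cong (ℚ._+ F (suc n) j) (sum≤-coefficient F n j)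

*ₚ≈⊛ : ∀ p q → p *ₚ q Series₂.≋ p Series₂.⊛ q
*ₚ≈⊛ p q i j = ≡.trans (sumTo≡sum≤ _ i) (≡.trans
  (Series₁.sum≤-cong i (λ s _ → sumTo≡sum≤ _ j))
  (≡.sym (sum≤-coefficient (λ s → p s Series₁.⊛ q (i ∸ s)) i j)))

const1≈𝟙 : const 1ℚ Series₂.≋ Series₂.𝟙
const1≈𝟙 zero zero = ≡.refl
const1≈𝟙 zero (suc j) = ≡.refl
const1≈𝟙 (suc i) j = ≡.refl

Poly-commutativeRing : CommutativeRing 0ℓ 0ℓ
Poly-commutativeRing = record
  { Carrier = Poly
  ; _≈_ = Series₂._≋_
  ; _+_ = _+ₚ_
  ; _*_ = _*ₚ_
  ; -_ = -ₚ_
  ; 0# = zeroP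
  ; 1# = const 1ℚ
  ; isCommutativeRing = isCommutativeRing-resp-*-1 Series₂.commutativeRing _*ₚ_ (const 1ℚ) *ₚ≈⊛ const1≈𝟙
  }

-- Poly is a function type, so the fixed operand of a congruence such as *-congˡ cannot be
-- inferred by unification and is given explicitly.
open CommutativeRing Poly-commutativeRing hiding (zero)
open import Relation.Binary.Reasoning.Setoid setoid

sumTo-head : ∀ (f : ℕ → ℚ) n → (∀ s → f (suc s) ≡ 0ℚ) → sumTo f n ≡ f 0
sumTo-head f zero _ = ≡.refl
sumTo-head f (suc n) tail≡0 =
  ≡.trans (≡.cong₂ ℚ._+_ (sumTo-head f n tail≡0) (tail≡0 n)) (ℚ.+-identityʳ (f 0))

const-*ₚ : ∀ c p i j → (const c *ₚ p) i j ≡ c ℚ.* p i j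
const-*ₚ c p i j = ≡.trans (sumTo-head _ i later) first
  where
  first : sumTo (λ t → const c 0 t ℚ.* p i (j ∸ t)) j ≡ c ℚ.* p i j
  first = sumTo-head _ j (λ t → ℚ.*-zeroˡ (p i (j ∸ suc t)))
  later : ∀ s → sumTo (λ t → const c (suc s) t ℚ.* p (i ∸ suc s) (j ∸ t)) j ≡ 0ℚ
  later s = ≡.trans (sumTo-head _ j (λ t → ℚ.*-zeroˡ (p (i ∸ suc s) (j ∸ suc t))))
                    (ℚ.*-zeroˡ (p (i ∸ suc s) j))

const-+ : ∀ c d → const (c ℚ.+ d) ≈ const c + const d
const-+ c d zero zero = ≡.refl
const-+ c d zero (suc j) = ≡.refl
const-+ c d (suc i) j = ≡.refl

const-* : ∀ c d → const (c ℚ.* d) ≈ const c * const d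
const-* c d i j = ≡.trans (scale i j) (≡.sym (const-*ₚ c (const d) i j))
  where
  scale : ∀ i j → const (c ℚ.* d) i j ≡ c ℚ.* const d i j
  scale zero zero = ≡.refl
  scale zero (suc j) = ≡.sym (ℚ.*-zeroʳ c)
  scale (suc i) j = ≡.sym (ℚ.*-zeroʳ c)

const-neg : ∀ c → const (ℚ.- c) ≈ - const c
const-neg c zero zero = ≡.refl
const-neg c zero (suc j) = ≡.refl
const-neg c (suc i) j = ≡.refl

const-0 : const 0ℚ ≈ 0#
const-0 zero zero = ≡.refl
const-0 zero (suc j) = ≡.refl
const-0 (suc i) j = ≡.refl

const-homomorphism : ℚ.+-*-rawRing -Raw-AlmostCommutative⟶ fromCommutativeRing Poly-commutativeRing
const-homomorphism = record
  { ⟦_⟧ = const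
  ; +-homo = const-+
  ; *-homo = const-*
  ; -‿homo = const-neg
  ; 0-homo = const-0
  ; 1-homo = refl
  }

open import Algebra.Solver.Ring ℚ.+-*-rawRing (fromCommutativeRing Poly-commutativeRing) const-homomorphism
  (λ c d → Maybe.map (λ c≡d i j → ≡.cong (λ e → const e i j) c≡d) (dec⇒maybe (c ℚ.≟ d)))

open Exp commutativeSemiring using (_^_; ^-congˡ; ^-congʳ; ^-homo-*; ^-assocʳ; ^-distrib-*)

^ₚ≈^ : ∀ p n → p ^ₚ n ≈ p ^ n
^ₚ≈^ p zero = refl
^ₚ≈^ p (suc n) = *-congˡ {p} (^ₚ≈^ p n)

two : Poly
two = 1# + 1#

+/1-* : ∀ m n → + (m ℕ.* n) / 1 ≡ (+ m / 1) ℚ.* (+ n / 1)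
+/1-* m n = ≡.trans (≡.cong (_/ 1) (ℤ.pos-* m n))
  (≡.sym (≡.cong₂ ℚ._*_ (ℚ.normalize-coprime (coprime-1 m)) (ℚ.normalize-coprime (coprime-1 n))))
  where
  coprime-1 : ∀ m → Coprimality.Coprime m 1
  coprime-1 m = Coprimality.sym (Coprimality.1-coprimeTo m)

natP-* : ∀ m n → natP (m ℕ.* n) ≈ natP m * natP n
natP-* m n = trans (reflexive (≡.cong const (+/1-* m n))) (const-* (+ m / 1) (+ n / 1))

natP-2^ : ∀ n → natP (2 ℕ.^ n) ≈ two ^ n
natP-2^ zero = refl
natP-2^ (suc n) = trans (natP-* 2 (2 ℕ.^ n)) (*-cong (const-+ 1ℚ 1ℚ) (natP-2^ n))

degree : ℕ × ℕ → ℕ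
degree (i , j) = i ℕ.+ j

infixl 6 _+ᵉ_
_+ᵉ_ : ℕ × ℕ → ℕ × ℕ → ℕ × ℕ
(i , j) +ᵉ (i′ , j′) = i ℕ.+ i′ , j ℕ.+ j′

degree-+ᵉ : ∀ m m′ → degree (m +ᵉ m′) ≡ degree m ℕ.+ degree m′
degree-+ᵉ (i , j) (i′ , j′) = interchange i i′ j j′
  where open CommutativeSemigroupProperties ℕ.+-commutativeSemigroup using (interchange)

^-double : ∀ r n → r ^ (2 ℕ.* n) ≈ r ^ n * r ^ n
^-double r n = trans (^-homo-* r n (n ℕ.+ 0)) (*-congˡ {r ^ n} (^-congʳ r (ℕ.+-identityʳ n)))

module Homogeneous (p q : Poly) where

  geometric : ℕ → Poly
  geometric zero = 1#
  geometric (suc n) = p * geometric n + q ^ suc n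

  geometric-suc : ∀ n → geometric (suc n) ≈ q * geometric n + p ^ suc n
  geometric-suc zero = +-comm (p * 1#) (q ^ 1)
  geometric-suc (suc n) = begin
    p * geometric (suc n) + q * Q
      ≈⟨ +-congʳ {q * Q} (*-congˡ {p} (geometric-suc n)) ⟩
    p * (q * geometric n + P) + q * Q
      ≈⟨ solve 5 (λ p q g P Q → p :* (q :* g :+ P) :+ q :* Q := q :* (p :* g :+ Q) :+ p :* P)
                 refl p q (geometric n) P Q ⟩
    q * geometric (suc n) + p * P ∎
    where
    P = p ^ suc n
    Q = q ^ suc n

  ^-sub-^ : ∀ n → p ^ suc n - q ^ suc n ≈ (p - q) * geometric n
  ^-sub-^ zero = solve 2 (λ p q → p :* con 1ℚ :- q :* con 1ℚ := (p :- q) :* con 1ℚ) refl p q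
  ^-sub-^ (suc n) = begin
    p * P - q * Q
      ≈⟨ solve 4 (λ p q P Q → p :* P :- q :* Q := p :* (P :- Q) :+ (p :- q) :* Q) refl p q P Q ⟩
    p * (P - Q) + (p - q) * Q
      ≈⟨ +-congʳ {(p - q) * Q} (*-congˡ {p} (^-sub-^ n)) ⟩
    p * ((p - q) * geometric n) + (p - q) * Q
      ≈⟨ solve 4 (λ p q g Q → p :* ((p :- q) :* g) :+ (p :- q) :* Q := (p :- q) :* (p :* g :+ Q))
                 refl p q (geometric n) Q ⟩
    (p - q) * geometric (suc n) ∎
    where
    P = p ^ suc n
    Q = q ^ suc n

  -- The excess of 2ⁿ Σ pⁱ qⁿ⁻ⁱ over (p + q)ⁿ, written so that its coefficients are visibly non-negative.
  binomialDefect : ℕ → Poly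
  binomialDefect zero = 0#
  binomialDefect (suc n) = (p + q) * binomialDefect n + two ^ n * (p ^ suc n + q ^ suc n)

  two^*geometric : ∀ n → two ^ n * geometric n ≈ binomialDefect n + (p + q) ^ n
  two^*geometric zero = trans (*-identityˡ 1#) (sym (+-identityˡ 1#))
  two^*geometric (suc n) = begin
    two * t * geometric (suc n)
      ≈⟨ solve 2 (λ t g → (con 1ℚ :+ con 1ℚ) :* t :* g := t :* g :+ t :* g) refl t (geometric (suc n)) ⟩
    t * geometric (suc n) + t * geometric (suc n)
      ≈⟨ +-congˡ {t * geometric (suc n)} (*-congˡ {t} (geometric-suc n)) ⟩
    t * (p * geometric n + Q) + t * (q * geometric n + P)
      ≈⟨ solve 6 (λ t p q g P Q → t :* (p :* g :+ Q) :+ t :* (q :* g :+ P) := (p :+ q) :* (t :* g) :+ t :* (P :+ Q))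
                 refl t p q (geometric n) P Q ⟩
    (p + q) * (t * geometric n) + t * (P + Q)
      ≈⟨ +-congʳ {t * (P + Q)} (*-congˡ {p + q} (two^*geometric n)) ⟩
    (p + q) * (binomialDefect n + E) + t * (P + Q)
      ≈⟨ solve 5 (λ s D E t Z → s :* (D :+ E) :+ t :* Z := (s :* D :+ t :* Z) :+ s :* E)
                 refl (p + q) (binomialDefect n) E t (P + Q) ⟩
    binomialDefect (suc n) + (p + q) ^ suc n ∎
    where
    t = two ^ n
    E = (p + q) ^ n
    P = p ^ suc n
    Q = q ^ suc n

  twiceEvenPart twiceOddPart : ℕ → Poly
  twiceEvenPart zero = two
  twiceEvenPart (suc n) = p * twiceEvenPart n + q * twiceOddPart n
  twiceOddPart zero = 0#
  twiceOddPart (suc n) = p * twiceOddPart n + q * twiceEvenPart n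

  twiceParts : ∀ n → twiceEvenPart n ≈ (p + q) ^ n + (p - q) ^ n × twiceOddPart n ≈ (p + q) ^ n - (p - q) ^ n
  twiceParts zero = refl , sym (-‿inverseʳ 1#)
  twiceParts (suc n) =
      (begin
        p * twiceEvenPart n + q * twiceOddPart n
          ≈⟨ +-cong (*-congˡ {p} even) (*-congˡ {q} odd) ⟩
        p * (E + F) + q * (E - F)
          ≈⟨ solve 4 (λ p q E F → p :* (E :+ F) :+ q :* (E :- F) := (p :+ q) :* E :+ (p :- q) :* F)
                     refl p q E F ⟩
        (p + q) ^ suc n + (p - q) ^ suc n ∎)
    , (begin
        p * twiceOddPart n + q * twiceEvenPart n
          ≈⟨ +-cong (*-congˡ {p} odd) (*-congˡ {q} even) ⟩
        p * (E - F) + q * (E + F)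
          ≈⟨ solve 4 (λ p q E F → p :* (E :- F) :+ q :* (E :+ F) := (p :+ q) :* E :- (p :- q) :* F)
                     refl p q E F ⟩
        (p + q) ^ suc n - (p - q) ^ suc n ∎)
    where
    E = (p + q) ^ n
    F = (p - q) ^ n
    even = proj₁ (twiceParts n)
    odd = proj₂ (twiceParts n)

  square-sub-square : ∀ n → let S = two ^ n * geometric n; D = binomialDefect n in
    S * S - (p - q) ^ n * (p - q) ^ n ≈ (D + twiceOddPart n) * (D + twiceEvenPart n)
  square-sub-square n = begin
    S * S - F * F
      ≈⟨ +-congʳ { - (F * F)} (*-cong (two^*geometric n) (two^*geometric n)) ⟩
    (D + E) * (D + E) - F * F
      ≈⟨ solve 3 (λ D E F → (D :+ E) :* (D :+ E) :- F :* F := (D :+ (E :- F)) :* (D :+ (E :+ F))) refl D E F ⟩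
    (D + (E - F)) * (D + (E + F))
      ≈⟨ *-cong (+-congˡ {D} (sym (proj₂ (twiceParts n)))) (+-congˡ {D} (sym (proj₁ (twiceParts n)))) ⟩
    (D + twiceOddPart n) * (D + twiceEvenPart n) ∎
    where
    S = two ^ n * geometric n
    D = binomialDefect n
    E = (p + q) ^ n
    F = (p - q) ^ n

  monomial : ℕ × ℕ → Poly
  monomial (i , j) = p ^ i * q ^ j

  monomialSum : List (ℕ × ℕ) → Poly
  monomialSum [] = 0#
  monomialSum (m ∷ ms) = monomial m + monomialSum ms

  -- Non-negative integer combinations of the monomials pⁱ qʲ with i + j = d, as lists with repetitions.
  IsMonomialSum : ℕ → Poly → Set
  IsMonomialSum d r = Σ[ ms ∈ List (ℕ × ℕ) ] All (λ m → degree m ≡ d) ms × r ≈ monomialSum ms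

  monomial-+ᵉ : ∀ m m′ → monomial (m +ᵉ m′) ≈ monomial m * monomial m′
  monomial-+ᵉ (i , j) (i′ , j′) = begin
    p ^ (i ℕ.+ i′) * q ^ (j ℕ.+ j′)
      ≈⟨ *-cong (^-homo-* p i i′) (^-homo-* q j j′) ⟩
    (p ^ i * p ^ i′) * (q ^ j * q ^ j′)
      ≈⟨ solve 4 (λ a a′ b b′ → (a :* a′) :* (b :* b′) := (a :* b) :* (a′ :* b′))
                 refl (p ^ i) (p ^ i′) (q ^ j) (q ^ j′) ⟩
    (p ^ i * q ^ j) * (p ^ i′ * q ^ j′) ∎

  monomialSum-++ : ∀ ms ns → monomialSum (ms ++ ns) ≈ monomialSum ms + monomialSum ns
  monomialSum-++ [] ns = sym (+-identityˡ (monomialSum ns))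
  monomialSum-++ (m ∷ ms) ns =
    trans (+-congˡ {monomial m} (monomialSum-++ ms ns))
          (sym (+-assoc (monomial m) (monomialSum ms) (monomialSum ns)))

  monomialSum-map-+ᵉ : ∀ m ns → monomialSum (map (m +ᵉ_) ns) ≈ monomial m * monomialSum ns
  monomialSum-map-+ᵉ m [] = sym (zeroʳ (monomial m))
  monomialSum-map-+ᵉ m (n ∷ ns) = trans (+-cong (monomial-+ᵉ m n) (monomialSum-map-+ᵉ m ns))
                                        (sym (distribˡ (monomial m) (monomial n) (monomialSum ns)))

  monomialSum-cartesianProduct : ∀ ms ns →
    monomialSum (cartesianProductWith _+ᵉ_ ms ns) ≈ monomialSum ms * monomialSum ns
  monomialSum-cartesianProduct [] ns = sym (zeroˡ (monomialSum ns))
  monomialSum-cartesianProduct (m ∷ ms) ns = begin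
    monomialSum (map (m +ᵉ_) ns ++ cartesianProductWith _+ᵉ_ ms ns)
      ≈⟨ monomialSum-++ (map (m +ᵉ_) ns) (cartesianProductWith _+ᵉ_ ms ns) ⟩
    monomialSum (map (m +ᵉ_) ns) + monomialSum (cartesianProductWith _+ᵉ_ ms ns)
      ≈⟨ +-cong (monomialSum-map-+ᵉ m ns) (monomialSum-cartesianProduct ms ns) ⟩
    monomial m * monomialSum ns + monomialSum ms * monomialSum ns
      ≈⟨ distribʳ (monomialSum ns) (monomial m) (monomialSum ms) ⟨
    monomialSum (m ∷ ms) * monomialSum ns ∎

  IsMonomialSum-resp : ∀ {d r s} → r ≈ s → IsMonomialSum d r → IsMonomialSum d s
  IsMonomialSum-resp r≈s (ms , degrees , r≈Σ) = ms , degrees , trans (sym r≈s) r≈Σ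

  IsMonomialSum-0# : ∀ {d} → IsMonomialSum d 0#
  IsMonomialSum-0# = [] , [] , refl

  IsMonomialSum-+ : ∀ {d r s} → IsMonomialSum d r → IsMonomialSum d s → IsMonomialSum d (r + s)
  IsMonomialSum-+ (ms , ms-deg , r≈) (ns , ns-deg , s≈) =
    ms ++ ns , All.++⁺ ms-deg ns-deg , trans (+-cong r≈ s≈) (sym (monomialSum-++ ms ns))

  IsMonomialSum-* : ∀ {d e r s} → IsMonomialSum d r → IsMonomialSum e s → IsMonomialSum (d ℕ.+ e) (r * s)
  IsMonomialSum-* (ms , ms-deg , r≈) (ns , ns-deg , s≈) =
      cartesianProductWith _+ᵉ_ ms ns
    , All.cartesianProductWith⁺ (≡.setoid _) (≡.setoid _) _+ᵉ_ ms ns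
        (λ {m} {n} m∈ms n∈ns →
          ≡.trans (degree-+ᵉ m n) (≡.cong₂ ℕ._+_ (All.lookup ms-deg m∈ms) (All.lookup ns-deg n∈ns)))
    , trans (*-cong r≈ s≈) (sym (monomialSum-cartesianProduct ms ns))

  IsMonomialSum-two^* : ∀ {d r} m → IsMonomialSum d r → IsMonomialSum d (two ^ m * r)
  IsMonomialSum-two^* {r = r} zero r-sum = IsMonomialSum-resp (sym (*-identityˡ r)) r-sum
  IsMonomialSum-two^* {r = r} (suc m) r-sum = IsMonomialSum-resp
    (sym (solve 2 (λ t r → (con 1ℚ :+ con 1ℚ) :* t :* r := t :* r :+ t :* r) refl (two ^ m) r))
    (IsMonomialSum-+ (IsMonomialSum-two^* m r-sum) (IsMonomialSum-two^* m r-sum))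

  IsMonomialSum-p^ : ∀ n → IsMonomialSum n (p ^ n)
  IsMonomialSum-p^ n = (n , 0) ∷ [] , ℕ.+-identityʳ n ∷ [] , sym (trans (+-identityʳ _) (*-identityʳ (p ^ n)))

  IsMonomialSum-q^ : ∀ n → IsMonomialSum n (q ^ n)
  IsMonomialSum-q^ n = (0 , n) ∷ [] , ≡.refl ∷ [] , sym (trans (+-identityʳ _) (*-identityˡ (q ^ n)))

  IsMonomialSum-p : IsMonomialSum 1 p
  IsMonomialSum-p = IsMonomialSum-resp (*-identityʳ p) (IsMonomialSum-p^ 1)

  IsMonomialSum-q : IsMonomialSum 1 q
  IsMonomialSum-q = IsMonomialSum-resp (*-identityʳ q) (IsMonomialSum-q^ 1)

  IsMonomialSum-binomialDefect : ∀ n → IsMonomialSum n (binomialDefect n)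
  IsMonomialSum-binomialDefect zero = IsMonomialSum-0#
  IsMonomialSum-binomialDefect (suc n) = IsMonomialSum-+
    (IsMonomialSum-* (IsMonomialSum-+ IsMonomialSum-p IsMonomialSum-q) (IsMonomialSum-binomialDefect n))
    (IsMonomialSum-two^* n (IsMonomialSum-+ (IsMonomialSum-p^ (suc n)) (IsMonomialSum-q^ (suc n))))

  IsMonomialSum-twiceParts : ∀ n → IsMonomialSum n (twiceEvenPart n) × IsMonomialSum n (twiceOddPart n)
  IsMonomialSum-twiceParts zero = IsMonomialSum-+ (IsMonomialSum-p^ 0) (IsMonomialSum-p^ 0) , IsMonomialSum-0#
  IsMonomialSum-twiceParts (suc n) =
      IsMonomialSum-+ (IsMonomialSum-* IsMonomialSum-p even) (IsMonomialSum-* IsMonomialSum-q odd)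
    , IsMonomialSum-+ (IsMonomialSum-* IsMonomialSum-p odd) (IsMonomialSum-* IsMonomialSum-q even)
    where
    even = proj₁ (IsMonomialSum-twiceParts n)
    odd = proj₂ (IsMonomialSum-twiceParts n)

  IsMonomialSum-factors : ∀ n →
    IsMonomialSum (n ℕ.+ n) ((binomialDefect n + twiceOddPart n) * (binomialDefect n + twiceEvenPart n))
  IsMonomialSum-factors n = IsMonomialSum-*
    (IsMonomialSum-+ (IsMonomialSum-binomialDefect n) (proj₂ (IsMonomialSum-twiceParts n)))
    (IsMonomialSum-+ (IsMonomialSum-binomialDefect n) (proj₁ (IsMonomialSum-twiceParts n)))

sumTo-zero : ∀ (f : ℕ → ℚ) n → (∀ s → s ≤ n → f s ≡ 0ℚ) → sumTo f n ≡ 0ℚ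
sumTo-zero f zero f≡0 = f≡0 0 z≤n
sumTo-zero f (suc n) f≡0 =
  ≡.cong₂ ℚ._+_ (sumTo-zero f n (λ s s≤n → f≡0 s (ℕ.m≤n⇒m≤1+n s≤n))) (f≡0 (suc n) ℕ.≤-refl)

DegreeLE-* : ∀ {d e r s} → DegreeLE d r → DegreeLE e s → DegreeLE (d ℕ.+ e) (r * s)
DegreeLE-* {d} {e} {r} {s} r-deg s-deg i j d+e<i+j =
  sumTo-zero _ i (λ u u≤i → sumTo-zero _ j (λ v v≤j → term u v u≤i v≤j))
  where
  term : ∀ u v → u ≤ i → v ≤ j → r u v ℚ.* s (i ∸ u) (j ∸ v) ≡ 0ℚ
  term u v u≤i v≤j with d ℕ.<? u ℕ.+ v | e ℕ.<? (i ∸ u) ℕ.+ (j ∸ v)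
  ... | yes d<u+v | _ =
    ≡.trans (≡.cong (ℚ._* s (i ∸ u) (j ∸ v)) (r-deg u v d<u+v)) (ℚ.*-zeroˡ (s (i ∸ u) (j ∸ v)))
  ... | no _ | yes e<rest =
    ≡.trans (≡.cong (r u v ℚ.*_) (s-deg _ _ e<rest)) (ℚ.*-zeroʳ (r u v))
  ... | no d≮u+v | no e≮rest =
    ⊥-elim (ℕ.<⇒≱ d+e<i+j (≡.subst (ℕ._≤ d ℕ.+ e) split (ℕ.+-mono-≤ (ℕ.≮⇒≥ d≮u+v) (ℕ.≮⇒≥ e≮rest))))
    where
    split : (u ℕ.+ v) ℕ.+ ((i ∸ u) ℕ.+ (j ∸ v)) ≡ i ℕ.+ j
    split = ≡.trans (≡.sym (degree-+ᵉ (u , v) (i ∸ u , j ∸ v)))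
                    (≡.cong₂ ℕ._+_ (ℕ.m+[n∸m]≡n u≤i) (ℕ.m+[n∸m]≡n v≤j))

DegreeLE-- : ∀ {d r s} → DegreeLE d r → DegreeLE d s → DegreeLE d (r - s)
DegreeLE-- r-deg s-deg i j d<i+j rewrite r-deg i j d<i+j | s-deg i j d<i+j = ≡.refl

DegreeLE-1# : DegreeLE 0 1#
DegreeLE-1# zero zero ()
DegreeLE-1# zero (suc j) _ = ≡.refl
DegreeLE-1# (suc i) j _ = ≡.refl

DegreeLE-^ : ∀ {d r} m → DegreeLE d r → DegreeLE (m ℕ.* d) (r ^ m)
DegreeLE-^ zero r-deg = DegreeLE-1#
DegreeLE-^ (suc m) r-deg = DegreeLE-* r-deg (DegreeLE-^ m r-deg)

DegreeLE-varA : DegreeLE 1 varA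
DegreeLE-varA zero j _ = ≡.refl
DegreeLE-varA (suc zero) zero (ℕ.s≤s ())
DegreeLE-varA (suc zero) (suc j) _ = ≡.refl
DegreeLE-varA (suc (suc i)) j _ = ≡.refl

DegreeLE-varB : DegreeLE 1 varB
DegreeLE-varB zero zero ()
DegreeLE-varB zero (suc zero) (ℕ.s≤s ())
DegreeLE-varB zero (suc (suc j)) _ = ≡.refl
DegreeLE-varB (suc i) j _ = ≡.refl

a² b² : Poly
a² = varA ^ 2
b² = varB ^ 2

open Homogeneous a² b²

^ₚ-double : ∀ r k → r ^ₚ (2 ℕ.* k) ≈ (r ^ 2) ^ k
^ₚ-double r k = trans (^ₚ≈^ r (2 ℕ.* k)) (sym (^-assocʳ r 2 k))

target≈ : ∀ k → target k ≈ natP (2 ℕ.^ (2 ℕ.* (k ∸ 1))) * (a² ^ k - b² ^ k) ^ 2 - (a² - b²) ^ (2 ℕ.* k)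
target≈ k = +-cong (*-congˡ {natP (2 ℕ.^ (2 ℕ.* (k ∸ 1)))} squared) (-‿cong power)
  where
  squared : (varA ^ₚ (2 ℕ.* k) - varB ^ₚ (2 ℕ.* k)) ^ₚ 2 ≈ (a² ^ k - b² ^ k) ^ 2
  squared = trans (^ₚ≈^ (varA ^ₚ (2 ℕ.* k) - varB ^ₚ (2 ℕ.* k)) 2)
                  (^-congˡ 2 (+-cong (^ₚ-double varA k) (-‿cong (^ₚ-double varB k))))
  power : (varA ^ₚ 2 - varB ^ₚ 2) ^ₚ (2 ℕ.* k) ≈ (a² - b²) ^ (2 ℕ.* k)
  power = trans (^ₚ≈^ (varA ^ₚ 2 - varB ^ₚ 2) (2 ℕ.* k))
                (^-congˡ (2 ℕ.* k) (+-cong (^ₚ≈^ varA 2) (-‿cong (^ₚ≈^ varB 2))))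

target-factorization : ∀ n → target (suc n) ≈
  (a² - b²) * (a² - b²) * ((binomialDefect n + twiceOddPart n) * (binomialDefect n + twiceEvenPart n))
target-factorization n = begin
  target (suc n)
    ≈⟨ target≈ (suc n) ⟩
  natP (2 ℕ.^ (2 ℕ.* n)) * (a² ^ suc n - b² ^ suc n) ^ 2 - d ^ (2 ℕ.* suc n)
    ≈⟨ +-cong (*-cong (trans (natP-2^ (2 ℕ.* n)) (^-double two n)) (^-congˡ 2 (^-sub-^ n)))
              (-‿cong (^-double d (suc n))) ⟩
  (t * t) * (d * g) ^ 2 - (d * f) * (d * f)
    ≈⟨ solve 4 (λ t g f d → (t :* t) :* (d :* g) :^ 2 :- (d :* f) :* (d :* f)
                          := d :* d :* ((t :* g) :* (t :* g) :- f :* f)) refl t g f d ⟩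
  d * d * ((t * g) * (t * g) - f * f)
    ≈⟨ *-congˡ {d * d} (square-sub-square n) ⟩
  d * d * ((binomialDefect n + twiceOddPart n) * (binomialDefect n + twiceEvenPart n)) ∎
  where
  d = a² - b²
  t = two ^ n
  g = geometric n
  f = d ^ n

sosTerm : ℕ × ℕ → Poly
sosTerm (i , j) = varA ^ i * varB ^ j * (a² - b²)

^-square : ∀ r i → r ^ i * r ^ i ≈ (r ^ 2) ^ i
^-square r i = trans (sym (^-distrib-* r r i)) (^-congˡ i (*-congˡ {r} (sym (*-identityʳ r))))

sosTerm-square : ∀ m → sosTerm m * sosTerm m ≈ (a² - b²) * (a² - b²) * monomial m
sosTerm-square (i , j) = trans
  (solve 3 (λ u v d → (u :* v :* d) :* (u :* v :* d) := d :* d :* ((u :* u) :* (v :* v)))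
    refl (varA ^ i) (varB ^ j) (a² - b²))
  (*-congˡ {(a² - b²) * (a² - b²)} (*-cong (^-square varA i) (^-square varB j)))

sumSquares-map-sosTerm : ∀ ms → sumSquares (map sosTerm ms) ≈ (a² - b²) * (a² - b²) * monomialSum ms
sumSquares-map-sosTerm [] = sym (zeroʳ ((a² - b²) * (a² - b²)))
sumSquares-map-sosTerm (m ∷ ms) = trans (+-cong (sosTerm-square m) (sumSquares-map-sosTerm ms))
                                        (sym (distribˡ ((a² - b²) * (a² - b²)) (monomial m) (monomialSum ms)))

DegreeLE-sosTerm : ∀ n {m} → degree m ≡ n ℕ.+ n → DegreeLE (2 ℕ.* suc n) (sosTerm m)
DegreeLE-sosTerm n {i , j} i+j≡n+n = ≡.subst (λ d → DegreeLE d (sosTerm (i , j))) total-degree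
  (DegreeLE-* (DegreeLE-* (DegreeLE-^ i DegreeLE-varA) (DegreeLE-^ j DegreeLE-varB))
              (DegreeLE-- (DegreeLE-^ 2 DegreeLE-varA) (DegreeLE-^ 2 DegreeLE-varB)))
  where
  n+n+2≡2[1+n] : ∀ n → n ℕ.+ n ℕ.+ 2 ≡ 2 ℕ.* suc n
  n+n+2≡2[1+n] = solve-∀
  total-degree : i ℕ.* 1 ℕ.+ j ℕ.* 1 ℕ.+ 2 ≡ 2 ℕ.* suc n
  total-degree = ≡.trans (≡.cong₂ (λ u v → u ℕ.+ v ℕ.+ 2) (ℕ.*-identityʳ i) (ℕ.*-identityʳ j))
                         (≡.trans (≡.cong (ℕ._+ 2) i+j≡n+n) (n+n+2≡2[1+n] n))

lemma4p52 : (k : ℕ) → 1 ≤ k → IsSOSDeg (2 ℕ.* k) (target k)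
lemma4p52 zero ()
lemma4p52 (suc n) _ with IsMonomialSum-factors n
... | ms , degrees , factors≈ =
    map sosTerm ms
  , All.map⁺ (All.map (λ {m} → DegreeLE-sosTerm n {m}) degrees)
  , (begin
    target (suc n)                                       ≈⟨ target-factorization n ⟩
    d² * ((D + twiceOddPart n) * (D + twiceEvenPart n))  ≈⟨ *-congˡ {d²} factors≈ ⟩
    d² * monomialSum ms                                  ≈⟨ sumSquares-map-sosTerm ms ⟨
    sumSquares (map sosTerm ms)                          ∎)
  where
  d² = (a² - b²) * (a² - b²)
  D = binomialDefect n
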